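{- Let $C$ be a Costas array of order $n$, and let $\Delta$ be the set of ordered pairs $(i,j)$ such that there is a dot in position $(i,j)$ of $C$. Suppose there is an integer $r>1$ such that whenever $(i,j)\in\Delta$ and $r$ divides $i$, then $r$ also divides $j$. Write $n=rm+d$ with integers $m,d$ and $0\le d<r$. Then for each $u\in\{1,\dots,m\}$ there is a unique positive integer $v$ with $(ru,rv)\in\Delta$, and placing a dot in position $(u,v)$ for each such pair yields a Costas array of order $m$.
   Context: A Costas array of order $n$ is an $n\times n$ array of dots and blanks with exactly one dot in each row and each column, such that no two of the $\binom{n}{2}$ line segments joining two dots have the same length and slope. Equivalently, writing $\pi(i)=j$ when there is a dot at position $(i,j)$ (row $i$, column $j$), $\pi$ is a permutation of $\{1,\dots,n\}$ such that $\pi(i+k)-\pi(i)\ne\pi(j+k)-\pi(j)$ whenever $i\ne j$, $k\ge 1$, $1\le i<i+k\le n$ and $1\le j<j+k\le n$. -}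

module Defs where

open import Data.Nat using (ℕ; _≤_; _<_; _*_; _+_)
open import Data.Nat.Divisibility using (_∣_)
open import Data.Integer using (ℤ; +_; _-_)
open import Data.Product using (_×_; Σ; ∃)
open import Relation.Binary.PropositionalEquality using (_≡_; _≢_)

-- A permutation of {1,…,n}, represented by a function π : ℕ → ℕ
-- (only its values on 1..n matter): π(i) = j means a dot at (row i, column j).
record IsPerm (n : ℕ) (π : ℕ → ℕ) : Set where
  field
    range : ∀ i → 1 ≤ i → i ≤ n → 1 ≤ π i × π i ≤ n
    inj   : ∀ i j → 1 ≤ i → i ≤ n → 1 ≤ j → j ≤ n → π i ≡ π j → i ≡ j
    surj  : ∀ j → 1 ≤ j → j ≤ n → Σ ℕ (λ i → 1 ≤ i × i ≤ n × π i ≡ j)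

record IsCostas (n : ℕ) (π : ℕ → ℕ) : Set where
  field
    perm   : IsPerm n π
    costas : ∀ i j k → i ≢ j → 1 ≤ k → 1 ≤ i → i + k ≤ n → 1 ≤ j → j + k ≤ n →
             (+ π (i + k)) - (+ π i) ≢ (+ π (j + k)) - (+ π j)

Dot : ℕ → (ℕ → ℕ) → ℕ → ℕ → Set
Dot n π i j = 1 ≤ i × i ≤ n × π i ≡ j

-- Then π (r u) = r σ(u) for
-- σ(u) = π (r u) / r, and σ is a Costas array of order m.
--
-- Injectivity comes
--      from that of π; a repeated difference vector (k, σ(i+k) - σ(i)) of σ
--      would scale by r to a repeated difference vector (rk, …) of π.
--   3. The theorem: σ(u) = π (r u) / r satisfies the hypotheses of 2; the
--      bound σ(u) ≤ m uses r σ(u) ≤ n = r m + d < r (m + 1), and uniqueness of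
--      v with π (r u) = r v is cancellation of r.
module Submission where

open import Defs
open import Data.Nat using (ℕ; _≤_; _<_; _*_; _+_; zero; suc; z≤n; s≤s; z<s; _/_; NonZero; >-nonZero)
open import Data.Nat.Divisibility using (_∣_; m∣m*n)
open import Data.Nat.DivMod using (m*[n/m]≡n)
open import Data.Nat.Properties
open import Data.Integer as ℤ using (+_)
import Data.Integer.Properties as ℤ
open import Data.Product using (_×_; Σ; _,_; proj₁; proj₂)
open import Data.Sum using (_⊎_; inj₁; inj₂)
open import Data.Empty using (⊥-elim)
open import Relation.Nullary using (yes; no)
open import Relation.Binary.PropositionalEquality
  using (_≡_; _≢_; refl; sym; trans; cong; cong₂; subst; module ≡-Reasoning)

MapsInto : ℕ → (ℕ → ℕ) → Set
MapsInto m f = ∀ i → 1 ≤ i → i ≤ m → 1 ≤ f i × f i ≤ m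

InjectiveOn : ℕ → (ℕ → ℕ) → Set
InjectiveOn m f = ∀ i j → 1 ≤ i → i ≤ m → 1 ≤ j → j ≤ m → f i ≡ f j → i ≡ j

SurjectiveOn : ℕ → (ℕ → ℕ) → Set
SurjectiveOn m f = ∀ j → 1 ≤ j → j ≤ m → Σ ℕ (λ i → 1 ≤ i × i ≤ m × f i ≡ j)

below-top : ∀ {x m} → x ≤ suc m → x ≢ suc m → x ≤ m
below-top x≤1+m x≢1+m = ≤-pred (≤∧≢⇒< x≤1+m x≢1+m)

-- The map f on {1,…,m}, with the value m+1 redirected to f(m+1).  When f is
-- injective on {1,…,m+1} this maps {1,…,m} injectively into itself.
redirect : (ℕ → ℕ) → ℕ → ℕ → ℕ
redirect f m i with f i ≟ suc m
... | yes _ = f (suc m)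
... | no  _ = f i

redirect-cases : ∀ f m i →
  (f i ≡ suc m × redirect f m i ≡ f (suc m)) ⊎ (f i ≢ suc m × redirect f m i ≡ f i)
redirect-cases f m i with f i ≟ suc m
... | yes fi≡1+m = inj₁ (fi≡1+m , refl)
... | no  fi≢1+m = inj₂ (fi≢1+m , refl)

module _ (m : ℕ) (f : ℕ → ℕ) (into : MapsInto (suc m) f) (inj : InjectiveOn (suc m) f) where

  private
    top : 1 ≤ suc m
    top = s≤s z≤n

    misses-last : ∀ i → 1 ≤ i → i ≤ m → f i ≢ f (suc m)
    misses-last i 1≤i i≤m fi≡c =
      <⇒≢ (s≤s i≤m) (inj i (suc m) 1≤i (m≤n⇒m≤1+n i≤m) top ≤-refl fi≡c)

  -- a redirected value f(m+1) cannot be m+1, since f(i) = m+1 already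
  redirect-into : MapsInto m (redirect f m)
  redirect-into i 1≤i i≤m with redirect-cases f m i
  ... | inj₁ (fi≡1+m , gi≡c) =
    subst (λ x → 1 ≤ x × x ≤ m) (sym gi≡c)
      (proj₁ (into (suc m) top ≤-refl) ,
       below-top (proj₂ (into (suc m) top ≤-refl))
                 (λ c≡1+m → misses-last i 1≤i i≤m (trans fi≡1+m (sym c≡1+m))))
  ... | inj₂ (fi≢1+m , gi≡fi) =
    subst (λ x → 1 ≤ x × x ≤ m) (sym gi≡fi)
      (proj₁ (into i 1≤i (m≤n⇒m≤1+n i≤m)) ,
       below-top (proj₂ (into i 1≤i (m≤n⇒m≤1+n i≤m))) fi≢1+m)

  redirect-injective : InjectiveOn m (redirect f m)
  redirect-injective i k 1≤i i≤m 1≤k k≤m gi≡gk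
    with redirect-cases f m i | redirect-cases f m k
  ... | inj₁ (fi≡1+m , _) | inj₁ (fk≡1+m , _) =
    inj i k 1≤i (m≤n⇒m≤1+n i≤m) 1≤k (m≤n⇒m≤1+n k≤m) (trans fi≡1+m (sym fk≡1+m))
  ... | inj₁ (_ , gi≡c) | inj₂ (_ , gk≡fk) =
    ⊥-elim (misses-last k 1≤k k≤m (trans (sym gk≡fk) (trans (sym gi≡gk) gi≡c)))
  ... | inj₂ (_ , gi≡fi) | inj₁ (_ , gk≡c) =
    ⊥-elim (misses-last i 1≤i i≤m (trans (sym gi≡fi) (trans gi≡gk gk≡c)))
  ... | inj₂ (_ , gi≡fi) | inj₂ (_ , gk≡fk) =
    inj i k 1≤i (m≤n⇒m≤1+n i≤m) 1≤k (m≤n⇒m≤1+n k≤m)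
      (trans (sym gi≡fi) (trans gi≡gk gk≡fk))

  redirect-preimage : ∀ {j} → Σ ℕ (λ i → 1 ≤ i × i ≤ m × redirect f m i ≡ j) →
                      Σ ℕ (λ i → 1 ≤ i × i ≤ suc m × f i ≡ j)
  redirect-preimage (i , 1≤i , i≤m , gi≡j) with redirect-cases f m i
  ... | inj₁ (_ , gi≡c)  = suc m , top , ≤-refl , trans (sym gi≡c) gi≡j
  ... | inj₂ (_ , gi≡fi) = i , 1≤i , m≤n⇒m≤1+n i≤m , trans (sym gi≡fi) gi≡j

  -- The last value m+1 is attained: by m+1 itself, or else f(m+1) ≤ m is
  -- attained by redirect at some i ≤ m, which forces f i = m+1.
  last-attained : SurjectiveOn m (redirect f m) →
                  Σ ℕ (λ i → 1 ≤ i × i ≤ suc m × f i ≡ suc m)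
  last-attained surj′ with f (suc m) ≟ suc m
  ... | yes c≡1+m = suc m , top , ≤-refl , c≡1+m
  ... | no  c≢1+m with into (suc m) top ≤-refl
  ...   | 1≤c , c≤1+m with surj′ (f (suc m)) 1≤c (below-top c≤1+m c≢1+m)
  ...     | i , 1≤i , i≤m , gi≡c with redirect-cases f m i
  ...       | inj₁ (fi≡1+m , _) = i , 1≤i , m≤n⇒m≤1+n i≤m , fi≡1+m
  ...       | inj₂ (_ , gi≡fi) =
    ⊥-elim (misses-last i 1≤i i≤m (trans (sym gi≡fi) gi≡c))

  redirect-surjective⇒surjective : SurjectiveOn m (redirect f m) → SurjectiveOn (suc m) f
  redirect-surjective⇒surjective surj′ j 1≤j j≤1+m with m≤n⇒m<n∨m≡n j≤1+m
  ... | inj₁ j<1+m = redirect-preimage (surj′ j 1≤j (≤-pred j<1+m))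
  ... | inj₂ refl  = last-attained surj′

injective⇒surjective : ∀ m f → MapsInto m f → InjectiveOn m f → SurjectiveOn m f
injective⇒surjective zero    f _    _   j 1≤j j≤0 = ⊥-elim (<⇒≱ 1≤j j≤0)
injective⇒surjective (suc m) f into inj =
  redirect-surjective⇒surjective m f into inj
    (injective⇒surjective m (redirect f m)
       (redirect-into m f into inj) (redirect-injective m f into inj))

scale-difference : ∀ r a b → + (r * a) ℤ.- + (r * b) ≡ + r ℤ.* (+ a ℤ.- + b)
scale-difference r a b = sym (begin
  + r ℤ.* (+ a ℤ.- + b)                   ≡⟨ ℤ.*-distribˡ-+ (+ r) (+ a) (ℤ.- + b) ⟩
  + r ℤ.* + a ℤ.+ + r ℤ.* (ℤ.- + b)       ≡⟨ cong (ℤ._+_ (+ r ℤ.* + a)) (sym (ℤ.neg-distribʳ-* (+ r) (+ b))) ⟩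
  + r ℤ.* + a ℤ.- + r ℤ.* + b             ≡⟨ cong₂ ℤ._-_ (sym (ℤ.pos-* r a)) (sym (ℤ.pos-* r b)) ⟩
  + (r * a) ℤ.- + (r * b)                 ∎)
  where open ≡-Reasoning

row-bounds : ∀ {r m n} .{{_ : NonZero r}} → r * m ≤ n →
             ∀ {u} → 1 ≤ u → u ≤ m → 1 ≤ r * u × r * u ≤ n
row-bounds {r} rm≤n {u} 1≤u u≤m = ≤-trans 1≤u (m≤n*m u r) , ≤-trans (*-monoʳ-≤ r u≤m) rm≤n

contraction : ∀ {n m r π σ} .{{_ : NonZero r}} → IsCostas n π → r * m ≤ n →
              MapsInto m σ → (∀ u → 1 ≤ u → u ≤ m → π (r * u) ≡ r * σ u) →
              IsCostas m σ
contraction {n} {m} {r} {π} {σ} C rm≤n into π≡rσ = record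
  { perm   = record { range = into ; inj = injective
                    ; surj = injective⇒surjective m σ into injective }
  ; costas = no-repeated-difference
  }
  where
  open IsPerm (IsCostas.perm C) using (inj)

  injective : InjectiveOn m σ
  injective i j 1≤i i≤m 1≤j j≤m σi≡σj = *-cancelˡ-≡ i j r (inj (r * i) (r * j)
    (proj₁ (row-bounds rm≤n 1≤i i≤m)) (proj₂ (row-bounds rm≤n 1≤i i≤m))
    (proj₁ (row-bounds rm≤n 1≤j j≤m)) (proj₂ (row-bounds rm≤n 1≤j j≤m))
    (begin
      π (r * i) ≡⟨ π≡rσ i 1≤i i≤m ⟩
      r * σ i   ≡⟨ cong (r *_) σi≡σj ⟩
      r * σ j   ≡⟨ sym (π≡rσ j 1≤j j≤m) ⟩
      π (r * j) ∎))
    where open ≡-Reasoning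

  scaled-difference : ∀ i k → 1 ≤ i → i + k ≤ m →
    + π (r * i + r * k) ℤ.- + π (r * i) ≡ + r ℤ.* (+ σ (i + k) ℤ.- + σ i)
  scaled-difference i k 1≤i i+k≤m = begin
    + π (r * i + r * k) ℤ.- + π (r * i)   ≡⟨ cong (λ x → + π x ℤ.- + π (r * i)) (sym (*-distribˡ-+ r i k)) ⟩
    + π (r * (i + k)) ℤ.- + π (r * i)     ≡⟨ cong₂ (λ x y → + x ℤ.- + y)
                                             (π≡rσ (i + k) (≤-trans 1≤i (m≤m+n i k)) i+k≤m)
                                             (π≡rσ i 1≤i (≤-trans (m≤m+n i k) i+k≤m)) ⟩
    + (r * σ (i + k)) ℤ.- + (r * σ i)     ≡⟨ scale-difference r (σ (i + k)) (σ i) ⟩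
    + r ℤ.* (+ σ (i + k) ℤ.- + σ i)       ∎
    where open ≡-Reasoning

  scaled-end : ∀ i k → i + k ≤ m → r * i + r * k ≤ n
  scaled-end i k i+k≤m =
    ≤-trans (≤-reflexive (sym (*-distribˡ-+ r i k))) (≤-trans (*-monoʳ-≤ r i+k≤m) rm≤n)

  no-repeated-difference : ∀ i j k → i ≢ j → 1 ≤ k → 1 ≤ i → i + k ≤ m → 1 ≤ j → j + k ≤ m →
    + σ (i + k) ℤ.- + σ i ≢ + σ (j + k) ℤ.- + σ j
  no-repeated-difference i j k i≢j 1≤k 1≤i i+k≤m 1≤j j+k≤m same =
    IsCostas.costas C (r * i) (r * j) (r * k)
      (λ ri≡rj → i≢j (*-cancelˡ-≡ i j r ri≡rj))
      (≤-trans 1≤k (m≤n*m k r))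
      (≤-trans 1≤i (m≤n*m i r)) (scaled-end i k i+k≤m)
      (≤-trans 1≤j (m≤n*m j r)) (scaled-end j k j+k≤m)
      (begin
        + π (r * i + r * k) ℤ.- + π (r * i) ≡⟨ scaled-difference i k 1≤i i+k≤m ⟩
        + r ℤ.* (+ σ (i + k) ℤ.- + σ i)     ≡⟨ cong (+ r ℤ.*_) same ⟩
        + r ℤ.* (+ σ (j + k) ℤ.- + σ j)     ≡⟨ sym (scaled-difference j k 1≤j j+k≤m) ⟩
        + π (r * j + r * k) ℤ.- + π (r * j) ∎)
    where open ≡-Reasoning

positive-factor : ∀ r q → 1 ≤ r * q → 1 ≤ q
positive-factor r zero    1≤r*0 = ⊥-elim (<⇒≱ 1≤r*0 (≤-reflexive (*-zeroʳ r)))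
positive-factor r (suc q) _     = s≤s z≤n

quotient-bound : ∀ r m d q → r * q ≤ r * m + d → d < r → q ≤ m
quotient-bound r m d q rq≤rm+d d<r = ≤-pred (*-cancelˡ-< r q (suc m) (begin-strict
  r * q      ≤⟨ rq≤rm+d ⟩
  r * m + d  <⟨ +-monoʳ-< (r * m) d<r ⟩
  r * m + r  ≡⟨ +-comm (r * m) r ⟩
  r + r * m  ≡⟨ sym (*-suc r m) ⟩
  r * suc m  ∎))
  where open ≤-Reasoning

lemma1 : (n : ℕ) (π : ℕ → ℕ) → IsCostas n π →
         (r : ℕ) → 1 < r →
         (∀ i j → Dot n π i j → r ∣ i → r ∣ j) →
         (m d : ℕ) → n ≡ r * m + d → d < r →
         (∀ u → 1 ≤ u → u ≤ m →
            Σ ℕ (λ v → (1 ≤ v × Dot n π (r * u) (r * v)) ×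
              (∀ v′ → 1 ≤ v′ → Dot n π (r * u) (r * v′) → v′ ≡ v)))
         × Σ (ℕ → ℕ) (λ σ → (∀ u → 1 ≤ u → u ≤ m → 1 ≤ σ u × Dot n π (r * u) (r * σ u))
                             × IsCostas m σ)
lemma1 n π C r 1<r closed m d n≡rm+d d<r =
  unique-column , σ , dot-at , contraction C rm≤n σ-into π≡rσ
  where
  instance
    r-nonZero : NonZero r
    r-nonZero = >-nonZero (<-trans z<s 1<r)

  rm≤n : r * m ≤ n
  rm≤n = ≤-trans (m≤m+n (r * m) d) (≤-reflexive (sym n≡rm+d))

  σ : ℕ → ℕ
  σ u = π (r * u) / r

  -- the dot in row r u lies in a column divisible by r, namely r σ(u)
  π≡rσ : ∀ u → 1 ≤ u → u ≤ m → π (r * u) ≡ r * σ u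
  π≡rσ u 1≤u u≤m = sym (m*[n/m]≡n
    (closed (r * u) (π (r * u)) (proj₁ ru-row , proj₂ ru-row , refl) (m∣m*n u)))
    where
    ru-row : 1 ≤ r * u × r * u ≤ n
    ru-row = row-bounds rm≤n 1≤u u≤m

  σ-into : MapsInto m σ
  σ-into u 1≤u u≤m =
      positive-factor r (σ u) (subst (1 ≤_) (π≡rσ u 1≤u u≤m) (proj₁ π-range))
    , quotient-bound r m d (σ u)
        (subst (_≤ r * m + d) (π≡rσ u 1≤u u≤m) (subst (π (r * u) ≤_) n≡rm+d (proj₂ π-range)))
        d<r
    where
    π-range : 1 ≤ π (r * u) × π (r * u) ≤ n
    π-range = IsPerm.range (IsCostas.perm C) (r * u)
                (proj₁ (row-bounds rm≤n 1≤u u≤m)) (proj₂ (row-bounds rm≤n 1≤u u≤m))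

  dot-at : ∀ u → 1 ≤ u → u ≤ m → 1 ≤ σ u × Dot n π (r * u) (r * σ u)
  dot-at u 1≤u u≤m = proj₁ (σ-into u 1≤u u≤m) , proj₁ ru-row , proj₂ ru-row , π≡rσ u 1≤u u≤m
    where
    ru-row : 1 ≤ r * u × r * u ≤ n
    ru-row = row-bounds rm≤n 1≤u u≤m

  unique-column : ∀ u → 1 ≤ u → u ≤ m →
    Σ ℕ (λ v → (1 ≤ v × Dot n π (r * u) (r * v)) ×
      (∀ v′ → 1 ≤ v′ → Dot n π (r * u) (r * v′) → v′ ≡ v))
  unique-column u 1≤u u≤m = σ u , dot-at u 1≤u u≤m ,
    λ v′ _ (_ , _ , π≡rv′) → *-cancelˡ-≡ v′ (σ u) r (trans (sym π≡rv′) (π≡rσ u 1≤u u≤m))
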